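{- For all integers $k \ge 2$, $m(k) \le 2\lfloor \log_2 k \rfloor$.
   Context: A topology on a finite set $X$ is a collection of subsets of $X$ containing $\emptyset$ and $X$ and closed under unions and finite intersections; its members are open sets. For an integer $k \ge 2$, $m(k)$ is the smallest positive integer $n$ such that there exists a topology on an $n$-point set having exactly $k$ open sets. -}

module Defs where

open import Data.Nat using (ℕ)
open import Data.List using (List; length)
open import Data.List.Membership.Propositional using (_∈_)
open import Data.List.Relation.Unary.Unique.Propositional using (Unique)
open import Data.Fin.Subset using (Subset; ⊥; ⊤; _∪_; _∩_)
open import Data.Product using (_×_; Σ)
open import Relation.Binary.PropositionalEquality using (_≡_)

-- Since the collection is finite, closure under
-- arbitrary unions is equivalent to containing ∅ plus closure under
-- binary unions.
record IsTopology {n : ℕ} (opens : List (Subset n)) : Set where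
  field
    distinct : Unique opens
    empty-open : ⊥ ∈ opens
    full-open : ⊤ ∈ opens
    ∪-open : ∀ {U V} → U ∈ opens → V ∈ opens → (U ∪ V) ∈ opens
    ∩-open : ∀ {U V} → U ∈ opens → V ∈ opens → (U ∩ V) ∈ opens

HasTopologyWith : ℕ → ℕ → Set
HasTopologyWith n k = Σ (List (Subset n)) (λ opens → IsTopology opens × length opens ≡ k)

-- Write k = 2j or k = 2j + 1.  From a topology with j open sets on n points, adjoining an
-- isolated point doubles the number of open sets, and then adjoining a point lying in
-- every non-empty open set adds one more.  Halving k costs at most two points and lowers
-- ⌊log₂ k⌋ by one; the one-point topology on the empty set starts the recursion at k = 1.
module Submission where

open import Defs
open import Data.Nat using (ℕ; zero; suc; _≤_; _<_; _*_; _+_; z≤n; s≤s; z<s; NonZero; ≢-nonZero⁻¹)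
open import Data.Nat.Logarithm using (⌊log₂_⌋; ⌊log₂⌋-mono-≤; ⌊log₂[2*b]⌋≡1+⌊log₂b⌋)
open import Data.Nat.Properties using (≤-trans; n≤1+n; *-suc; *-monoʳ-≤; +-identityʳ; m<m+n; module ≤-Reasoning)
open import Data.Nat.Induction using (<-rec)
open import Data.Bool using (true; false; _∨_; _∧_)
open import Data.Vec using ([]; _∷_)
open import Data.Vec.Properties using (∷-injectiveʳ)
open import Data.List using (List; []; _∷_; map; _++_; length)
open import Data.List.Properties using (length-++; length-map)
open import Data.List.Membership.Propositional using (_∈_)
open import Data.List.Membership.Propositional.Properties using (∈-map⁺; ∈-map⁻; ∈-++⁺ˡ; ∈-++⁺ʳ; ∈-++⁻)
open import Data.List.Relation.Unary.Any using (here; there)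
open import Data.List.Relation.Unary.All as All using ()
open import Data.List.Relation.Unary.AllPairs using ([]; _∷_)
open import Data.List.Relation.Unary.Unique.Propositional using (Unique)
import Data.List.Relation.Unary.Unique.Propositional.Properties as Unique
open import Data.List.Relation.Binary.Disjoint.Propositional using (Disjoint)
open import Data.Fin.Subset using (Subset; ⊥; _∪_; _∩_)
open import Data.Fin.Subset.Properties using (∪-identityˡ; ∪-identityʳ; ∩-zeroˡ; ∩-zeroʳ)
open import Data.Product using (Σ; _×_; _,_)
open import Data.Sum using (inj₁; inj₂)
open import Relation.Nullary using (contradiction)
open import Relation.Binary.PropositionalEquality using (_≡_; _≢_; refl; sym; trans; cong; cong₂; subst)

open IsTopology

private
  variable
    n : ℕ
    os : List (Subset n)

withIsolatedPoint : List (Subset n) → List (Subset (suc n))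
withIsolatedPoint os = map (false ∷_) os ++ map (true ∷_) os

data IsolatedLift (os : List (Subset n)) : Subset (suc n) → Set where
  lift : ∀ b {U} → U ∈ os → IsolatedLift os (b ∷ U)

∈-withIsolatedPoint⁺ : ∀ b {U} → U ∈ os → (b ∷ U) ∈ withIsolatedPoint os
∈-withIsolatedPoint⁺ false U∈os = ∈-++⁺ˡ (∈-map⁺ (false ∷_) U∈os)
∈-withIsolatedPoint⁺ {os = os} true U∈os = ∈-++⁺ʳ (map (false ∷_) os) (∈-map⁺ (true ∷_) U∈os)

∈-withIsolatedPoint⁻ : ∀ {x} → x ∈ withIsolatedPoint os → IsolatedLift os x
∈-withIsolatedPoint⁻ {os = os} x∈ with ∈-++⁻ (map (false ∷_) os) x∈
... | inj₁ x∈false with ∈-map⁻ (false ∷_) x∈false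
...   | _ , U∈os , refl = lift false U∈os
∈-withIsolatedPoint⁻ {os = os} x∈ | inj₂ x∈true with ∈-map⁻ (true ∷_) x∈true
...   | _ , U∈os , refl = lift true U∈os

withIsolatedPoint-isTopology : IsTopology os → IsTopology (withIsolatedPoint os)
withIsolatedPoint-isTopology {os = os} τ = record
  { distinct = Unique.++⁺ (Unique.map⁺ ∷-injectiveʳ (distinct τ))
                          (Unique.map⁺ ∷-injectiveʳ (distinct τ)) apart
  ; empty-open = ∈-withIsolatedPoint⁺ false (empty-open τ)
  ; full-open = ∈-withIsolatedPoint⁺ true (full-open τ)
  ; ∪-open = λ x∈ y∈ → union (∈-withIsolatedPoint⁻ x∈) (∈-withIsolatedPoint⁻ y∈)
  ; ∩-open = λ x∈ y∈ → inter (∈-withIsolatedPoint⁻ x∈) (∈-withIsolatedPoint⁻ y∈)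
  }
  where
  apart : Disjoint (map (false ∷_) os) (map (true ∷_) os)
  apart (x∈false , x∈true) with ∈-map⁻ (false ∷_) x∈false | ∈-map⁻ (true ∷_) x∈true
  ... | _ , _ , refl | _ , _ , ()

  union : ∀ {x y} → IsolatedLift os x → IsolatedLift os y → (x ∪ y) ∈ withIsolatedPoint os
  union (lift b U∈os) (lift c V∈os) = ∈-withIsolatedPoint⁺ (b ∨ c) (∪-open τ U∈os V∈os)

  inter : ∀ {x y} → IsolatedLift os x → IsolatedLift os y → (x ∩ y) ∈ withIsolatedPoint os
  inter (lift b U∈os) (lift c V∈os) = ∈-withIsolatedPoint⁺ (b ∧ c) (∩-open τ U∈os V∈os)

length-withIsolatedPoint : (os : List (Subset n)) → length (withIsolatedPoint os) ≡ 2 * length os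
length-withIsolatedPoint os = trans (length-++ (map (false ∷_) os))
  (cong₂ _+_ (length-map _ os) (trans (length-map _ os) (sym (+-identityʳ _))))

withDensePoint : List (Subset n) → List (Subset (suc n))
withDensePoint os = ⊥ ∷ map (true ∷_) os

data DenseLift (os : List (Subset n)) : Subset (suc n) → Set where
  empty : DenseLift os ⊥
  lift : ∀ {U} → U ∈ os → DenseLift os (true ∷ U)

∈-withDensePoint⁺ : ∀ {x} → DenseLift os x → x ∈ withDensePoint os
∈-withDensePoint⁺ empty = here refl
∈-withDensePoint⁺ (lift U∈os) = there (∈-map⁺ (true ∷_) U∈os)

∈-withDensePoint⁻ : ∀ {x} → x ∈ withDensePoint os → DenseLift os x
∈-withDensePoint⁻ (here refl) = empty
∈-withDensePoint⁻ (there x∈) with ∈-map⁻ (true ∷_) x∈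
... | _ , U∈os , refl = lift U∈os

withDensePoint-isTopology : IsTopology os → IsTopology (withDensePoint os)
withDensePoint-isTopology {os = os} τ = record
  { distinct = All.tabulate ⊥∉lifts ∷ Unique.map⁺ ∷-injectiveʳ (distinct τ)
  ; empty-open = ∈-withDensePoint⁺ empty
  ; full-open = ∈-withDensePoint⁺ (lift (full-open τ))
  ; ∪-open = λ x∈ y∈ → ∈-withDensePoint⁺ (union (∈-withDensePoint⁻ x∈) (∈-withDensePoint⁻ y∈))
  ; ∩-open = λ x∈ y∈ → ∈-withDensePoint⁺ (inter (∈-withDensePoint⁻ x∈) (∈-withDensePoint⁻ y∈))
  }
  where
  ⊥∉lifts : ∀ {x} → x ∈ map (true ∷_) os → ⊥ ≢ x
  ⊥∉lifts x∈ refl with ∈-map⁻ (true ∷_) x∈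
  ... | _ , _ , ()

  union : ∀ {x y} → DenseLift os x → DenseLift os y → DenseLift os (x ∪ y)
  union empty V = subst (DenseLift os) (sym (∪-identityˡ _)) V
  union U empty = subst (DenseLift os) (sym (∪-identityʳ _)) U
  union (lift U∈os) (lift V∈os) = lift (∪-open τ U∈os V∈os)

  inter : ∀ {x y} → DenseLift os x → DenseLift os y → DenseLift os (x ∩ y)
  inter empty _ = subst (DenseLift os) (sym (∩-zeroˡ _)) empty
  inter _ empty = subst (DenseLift os) (sym (∩-zeroʳ _)) empty
  inter (lift U∈os) (lift V∈os) = lift (∩-open τ U∈os V∈os)

length-withDensePoint : (os : List (Subset n)) → length (withDensePoint os) ≡ suc (length os)
length-withDensePoint os = cong suc (length-map _ os)

hasTopologyWith-double : ∀ {k} → HasTopologyWith n k → HasTopologyWith (suc n) (2 * k)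
hasTopologyWith-double (os , τ , refl) =
  withIsolatedPoint os , withIsolatedPoint-isTopology τ , length-withIsolatedPoint os

hasTopologyWith-suc : ∀ {k} → HasTopologyWith n k → HasTopologyWith (suc n) (suc k)
hasTopologyWith-suc (os , τ , refl) =
  withDensePoint os , withDensePoint-isTopology τ , length-withDensePoint os

hasTopologyWith-0-1 : HasTopologyWith 0 1
hasTopologyWith-0-1 = ⊥ ∷ [] , τ , refl
  where
  τ : IsTopology (⊥ ∷ [])
  τ = record
    { distinct = All.[] ∷ []
    ; empty-open = here refl
    ; full-open = here refl
    ; ∪-open = λ { (here refl) (here refl) → here refl }
    ; ∩-open = λ { (here refl) (here refl) → here refl }
    }

length≤1-unique-allEqual : ∀ {a} {A : Set a} {xs : List A} →
  (∀ (x y : A) → x ≡ y) → Unique xs → length xs ≤ 1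
length≤1-unique-allEqual {xs = []} _ _ = z≤n
length≤1-unique-allEqual {xs = _ ∷ []} _ _ = s≤s z≤n
length≤1-unique-allEqual {xs = x ∷ y ∷ _} allEqual ((x≢y All.∷ _) ∷ _) = contradiction (allEqual x y) x≢y

hasTopologyWith-0⇒≤1 : ∀ {k} → HasTopologyWith 0 k → k ≤ 1
hasTopologyWith-0⇒≤1 (os , τ , refl) = length≤1-unique-allEqual (λ { [] [] → refl }) (distinct τ)

data Parity : ℕ → Set where
  even : ∀ j → Parity (2 * j)
  odd : ∀ j → Parity (suc (2 * j))

parity : ∀ k → Parity k
parity zero = even 0
parity (suc k) with parity k
... | even j = odd j
... | odd j = subst Parity (*-suc 2 j) (even (suc j))

+2≤2*⌊log₂[2*j]⌋ : ∀ {m} j .{{_ : NonZero j}} → m ≤ 2 * ⌊log₂ j ⌋ → 2 + m ≤ 2 * ⌊log₂ (2 * j) ⌋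
+2≤2*⌊log₂[2*j]⌋ {m} j m≤ = begin
  2 + m                   ≤⟨ s≤s (s≤s m≤) ⟩
  2 + 2 * ⌊log₂ j ⌋       ≡⟨ *-suc 2 ⌊log₂ j ⌋ ⟨
  2 * (1 + ⌊log₂ j ⌋)     ≡⟨ cong (2 *_) (⌊log₂[2*b]⌋≡1+⌊log₂b⌋ j) ⟨
  2 * ⌊log₂ (2 * j) ⌋     ∎
  where open ≤-Reasoning

LogSizedTopology : ℕ → Set
LogSizedTopology k = Σ ℕ (λ n → n ≤ 2 * ⌊log₂ k ⌋ × HasTopologyWith n k)

logSizedTopology : ∀ k .{{_ : NonZero k}} → LogSizedTopology k
logSizedTopology = <-rec (λ k → .{{NonZero k}} → LogSizedTopology k) step
  where
  step : ∀ k → (∀ {j} → j < k → .{{NonZero j}} → LogSizedTopology j) → .{{NonZero k}} → LogSizedTopology k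
  step k rec with parity k
  ... | even zero = contradiction refl (≢-nonZero⁻¹ 0)
  ... | odd zero = 0 , z≤n , hasTopologyWith-0-1
  ... | even (suc j) with rec (m<m+n (suc j) z<s)
  ...   | n , n≤ , T =
    suc n , ≤-trans (n≤1+n _) (+2≤2*⌊log₂[2*j]⌋ (suc j) n≤) , hasTopologyWith-double T
  step k rec | odd (suc j) with rec (≤-trans (m<m+n (suc j) z<s) (n≤1+n _))
  ...   | n , n≤ , T =
    2 + n , ≤-trans (+2≤2*⌊log₂[2*j]⌋ (suc j) n≤) (*-monoʳ-≤ 2 (⌊log₂⌋-mono-≤ (n≤1+n (2 * suc j))))
          , hasTopologyWith-suc (hasTopologyWith-double T)

proposition3p3 : ∀ (k : ℕ) → 2 ≤ k →
    Σ ℕ (λ n → (1 ≤ n × n ≤ 2 * ⌊log₂ k ⌋) × HasTopologyWith n k)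
proposition3p3 k@(suc _) 2≤k with logSizedTopology k
... | zero , _ , T = contradiction (≤-trans 2≤k (hasTopologyWith-0⇒≤1 T)) λ { (s≤s ()) }
... | suc n , n≤ , T = suc n , (s≤s z≤n , n≤) , T
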